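{- Let $\mathcal{C}\subseteq\mathcal{T}$ be a subcategory and $\sim$ a congruence relation on $\mathcal{C}$, and assume Axiom 1: $\mathcal{C}$ contains every morphism of $\mathcal{T}$ that is an injective induced graph map. Then: (i) if a triad ${\rm Tr}_{\mu w}$ has an alcove, then every ordered triple of distinct actors of ${\rm Tr}_{\mu w}$ has an alcove at it; (ii) for any affiliation network $G$ and actors $i,j,k$ of $G$, there is a bijection between the wedges at $(i,j,k)$ and the wedges at $(k,j,i)$ that maps open wedges to open wedges and closed wedges to closed wedges.
   Context: An affiliation network (AN) is a finite simple undirected bipartite graph whose nodes are actors and events, each edge joining an actor to an event. A graph map sends nodes to nodes and edges to edges; it is injective if injective on nodes and induced if its image is an induced subgraph of the target. For a set $S$ of actors of $G$, the subgraph scheduled by $S$ is induced by $S$ together with all events attended by at least two actors of $S$; a triad of $G$ is the subgraph scheduled by three actors. For integers $\mu_1\ge\mu_2\ge\mu_3\ge0$, $w\ge0$, ${\rm Tr}_{\mu w}$ is the AN with actors $p,q,r$, exactly $\mu_1$ events attended by exactly $p,q$, $\mu_2$ by exactly $q,r$, $\mu_3$ by exactly $p,r$, and $w$ by all three. $\mathcal{T}$: objects are triads (ANs with three actors, each event attended by at least two), morphisms $H\to K$ are graph maps sending actors of $H$ to distinct actors of $K$ and events to events. A congruence relation is a family of equivalence relations on hom-sets compatible with composition. Fixed: $W$ = path $v_0v_1v_2v_3v_4$ (actors $v_0,v_2,v_4$; events $v_1,v_3$), $X$ = 6-cycle $v_0v_1\cdots v_5v_0$ (actors $v_0,v_2,v_4$;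 events $v_1,v_3,v_5$), $\iota:W\to X$, $\iota(v_i)=v_i$. For an AN $G$ (a triad being an AN), $\mathsf{Hom}_{\mathcal{C}/\sim}(H,G)$ is the set of $\sim$-classes of morphisms in $\mathcal{C}$ from $H$ into triads of $G$. Wedges are elements of $\mathsf{Hom}_{\mathcal{C}/\sim}(W,G)$; a wedge $\phi$ is closed if $\phi\sim\psi\circ\iota$ for some morphism $\psi$ in $\mathcal{C}$ from $X$ into a triad of $G$, open otherwise; alcoves are elements of $\mathsf{Hom}_{\mathcal{C}/\sim}(X,G)$. A wedge or alcove is at the ordered triple $(i,j,k)$ if it sends $v_0,v_2,v_4$ to $i,j,k$. -}

module Defs where

open import Data.Nat using (ℕ; zero; suc; _+_; _≤_; _<ᵇ_)
open import Data.Fin using (Fin; zero; suc; toℕ; splitAt)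
open import Data.Bool using (Bool; true; false; _∧_; _∨_; T)
open import Data.Unit using (tt)
open import Data.Sum using (_⊎_; inj₁; inj₂)
open import Data.Product using (Σ; _×_; _,_; proj₁; proj₂; ∃)
open import Relation.Binary.PropositionalEquality using (_≡_; _≢_; refl; cong)
open import Function using (_∘_; id; _∘′_)
open import Function.Definitions using (Injective)
open import Relation.Nullary using (¬_)

record AN : Set where
  field
    nA  : ℕ
    nE  : ℕ
    adj : Fin nA → Fin nE → Bool
open AN public

atLeast2 : Bool → Bool → Bool → Bool
atLeast2 b₀ b₁ b₂ = (b₀ ∧ b₁) ∨ (b₁ ∧ b₂) ∨ (b₀ ∧ b₂)

-- Objects of 𝒯: triads.  Actors are Fin 3, events form a finite type
-- (injects into some Fin m), each event attended by at least two actors.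

record Triad : Set₁ where
  field
    Ev     : Set
    evFin  : Σ ℕ λ m → Σ (Ev → Fin m) λ f → Injective _≡_ _≡_ f
    tadj   : Fin 3 → Ev → Bool
    ≥2     : ∀ e → T (atLeast2 (tadj zero e) (tadj (suc zero) e) (tadj (suc (suc zero)) e))
open Triad public

record Mor (H K : Triad) : Set where
  field
    fA    : Fin 3 → Fin 3
    fAinj : Injective _≡_ _≡_ fA
    fE    : Ev H → Ev K
    hom   : ∀ a e → T (tadj H a e) → T (tadj K (fA a) (fE e))
open Mor public

_≐_ : ∀ {H K} → Mor H K → Mor H K → Set
f ≐ g = (∀ a → fA f a ≡ fA g a) × (∀ e → fE f e ≡ fE g e)

idMor : (H : Triad) → Mor H H
idMor H = record { fA = id ; fAinj = id ; fE = id ; hom = λ a e p → p }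

_∘M_ : ∀ {H K L} → Mor K L → Mor H K → Mor H L
g ∘M f = record
  { fA = fA g ∘ fA f
  ; fAinj = λ p → fAinj f (fAinj g p)
  ; fE = fE g ∘ fE f
  ; hom = λ a e p → hom g (fA f a) (fE f e) (hom f a e p) }

InjectiveMap : ∀ {H K} → Mor H K → Set
InjectiveMap {H} {K} f = Injective _≡_ _≡_ (fA f) × Injective _≡_ _≡_ (fE f)

-- the image is an induced subgraph: every edge of K between image nodes
-- is the image of an edge of H
Induced : ∀ {H K} → Mor H K → Set
Induced {H} {K} f =
  ∀ a e → T (tadj K (fA f a) (fE f e)) →
  Σ (Fin 3) λ a′ → Σ (Ev H) λ e′ →
    T (tadj H a′ e′) × (fA f a′ ≡ fA f a) × (fE f e′ ≡ fE f e)

record CongSubcat : Set₁ where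
  field
    C      : ∀ {H K : Triad} → Mor H K → Set
    C-ext  : ∀ {H K} {f g : Mor H K} → f ≐ g → C f → C g
    C-id   : ∀ H → C (idMor H)
    C-∘    : ∀ {H K L} {f : Mor H K} {g : Mor K L} → C f → C g → C (g ∘M f)
    _∼_    : ∀ {H K : Triad} → Mor H K → Mor H K → Set
    ∼-ext  : ∀ {H K} {f g : Mor H K} → f ≐ g → f ∼ g   -- includes reflexivity
    ∼-sym  : ∀ {H K} {f g : Mor H K} → f ∼ g → g ∼ f
    ∼-trans : ∀ {H K} {f g h : Mor H K} → f ∼ g → g ∼ h → f ∼ h
    ∼-∘    : ∀ {H K L} {f f′ : Mor H K} {g g′ : Mor K L} →
             C f → C f′ → C g → C g′ → f ∼ f′ → g ∼ g′ → (g ∘M f) ∼ (g′ ∘M f′)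
open CongSubcat public

Axiom1 : CongSubcat → Set₁
Axiom1 S = ∀ {H K : Triad} (f : Mor H K) → InjectiveMap f → Induced f → C S f

-- Triads of an AN G: subgraph scheduled by a 3-set of actors, the 3-set
-- given canonically as a strictly increasing triple.

record Triple (G : AN) : Set where
  constructor triple
  field
    a₀ a₁ a₂ : Fin (nA G)
    lt₀₁ : T (toℕ a₀ <ᵇ toℕ a₁)
    lt₁₂ : T (toℕ a₁ <ᵇ toℕ a₂)
open Triple public

sel : ∀ {G} → Triple G → Fin 3 → Fin (nA G)
sel t zero = a₀ t
sel t (suc zero) = a₁ t
sel t (suc (suc zero)) = a₂ t

T-irr : ∀ {b} (x y : T b) → x ≡ y
T-irr {true} tt tt = refl

SchedEv : (G : AN) → Triple G → Set
SchedEv G t = Σ (Fin (nE G)) λ e →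
  T (atLeast2 (adj G (a₀ t) e) (adj G (a₁ t) e) (adj G (a₂ t) e))

schedInj : ∀ G t → Injective _≡_ _≡_ (λ (x : SchedEv G t) → proj₁ x)
schedInj G t {e , p} {.e , q} refl with T-irr p q
... | refl = refl

Sched : (G : AN) → Triple G → Triad
Sched G t = record
  { Ev = SchedEv G t
  ; evFin = nE G , (λ x → proj₁ x) , schedInj G t
  ; tadj = λ x e → adj G (sel t x) (proj₁ e)
  ; ≥2 = proj₂ }

-- Hom_{𝒞/∼}(H, G): morphisms of 𝒞 from H into triads of G, up to ∼.

module _ (S : CongSubcat) where

  record Arrow (H : Triad) (G : AN) : Set where
    constructor arr
    field
      tri : Triple G
      mor : Mor H (Sched G tri)
      inC : C S mor
  open Arrow public

  -- the relation whose classes are the elements of Hom_{𝒞/∼}(H,G)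
  data _≈_ {H : Triad} {G : AN} : Arrow H G → Arrow H G → Set where
    rel : ∀ {t} {φ ψ : Mor H (Sched G t)} {cφ : C S φ} {cψ : C S ψ} →
          _∼_ S φ ψ → arr t φ cφ ≈ arr t ψ cψ

  -- an arrow sits at the ordered triple (i,j,k) (actors v₀,v₂,v₄ ↦ i,j,k)
  At : ∀ {H G} → Arrow H G → Fin (nA G) → Fin (nA G) → Fin (nA G) → Set
  At a i j k = (sel (tri a) (fA (mor a) zero) ≡ i)
             × (sel (tri a) (fA (mor a) (suc zero)) ≡ j)
             × (sel (tri a) (fA (mor a) (suc (suc zero))) ≡ k)

-- The fixed triads W (path v₀v₁v₂v₃v₄) and X (6-cycle), and ι : W → X.
-- Actors v₀,v₂,v₄ = 0,1,2.  W events v₁,v₃ = 0,1;  X events v₁,v₃,v₅ = 0,1,2.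

wAdj : Fin 3 → Fin 2 → Bool
wAdj zero zero = true
wAdj (suc zero) zero = true
wAdj (suc zero) (suc zero) = true
wAdj (suc (suc zero)) (suc zero) = true
wAdj _ _ = false

xAdj : Fin 3 → Fin 3 → Bool
xAdj zero zero = true
xAdj (suc zero) zero = true
xAdj (suc zero) (suc zero) = true
xAdj (suc (suc zero)) (suc zero) = true
xAdj (suc (suc zero)) (suc (suc zero)) = true
xAdj zero (suc (suc zero)) = true
xAdj _ _ = false

wAdj≥2 : ∀ e → T (atLeast2 (wAdj zero e) (wAdj (suc zero) e) (wAdj (suc (suc zero)) e))
wAdj≥2 zero = tt
wAdj≥2 (suc zero) = tt

xAdj≥2 : ∀ e → T (atLeast2 (xAdj zero e) (xAdj (suc zero) e) (xAdj (suc (suc zero)) e))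
xAdj≥2 zero = tt
xAdj≥2 (suc zero) = tt
xAdj≥2 (suc (suc zero)) = tt

W : Triad
W = record { Ev = Fin 2 ; evFin = 2 , id , id ; tadj = wAdj ; ≥2 = wAdj≥2 }

X : Triad
X = record { Ev = Fin 3 ; evFin = 3 , id , id ; tadj = xAdj ; ≥2 = xAdj≥2 }

ιE : Fin 2 → Fin 3
ιE zero = zero
ιE (suc zero) = suc zero

ιhom : ∀ a e → T (wAdj a e) → T (xAdj a (ιE e))
ιhom zero zero p = p
ιhom (suc zero) zero p = p
ιhom (suc zero) (suc zero) p = p
ιhom (suc (suc zero)) (suc zero) p = p

ι : Mor W X
ι = record { fA = id ; fAinj = id ; fE = ιE ; hom = ιhom }

module _ (S : CongSubcat) (G : AN) where

  Wedge : Set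
  Wedge = Arrow S W G

  Alcove : Set
  Alcove = Arrow S X G

  -- φ ∼ ψ ∘ ι for some 𝒞-morphism ψ from X into a triad of G
  -- (necessarily the same triad, as ∼ only relates parallel morphisms)
  Closed : Wedge → Set
  Closed a = Σ (Mor X (Sched G (tri a))) λ ψ → C S ψ × _∼_ S (mor a) (ψ ∘M ι)

  WedgeAt : Fin (nA G) → Fin (nA G) → Fin (nA G) → Set
  WedgeAt i j k = Σ Wedge λ a → At S a i j k

  AlcoveAt : Fin (nA G) → Fin (nA G) → Fin (nA G) → Set
  AlcoveAt i j k = Σ Alcove λ a → At S a i j k

  -- a bijection between the sets of ∼-classes of wedges at (i,j,k) and at
  -- (i′,j′,k′), preserving closed and open wedges
  WedgeBijection : (i j k i′ j′ k′ : Fin (nA G)) → Set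
  WedgeBijection i j k i′ j′ k′ =
    Σ (WedgeAt i j k → WedgeAt i′ j′ k′) λ f →
      (∀ x y → _≈_ S (proj₁ x) (proj₁ y) → _≈_ S (proj₁ (f x)) (proj₁ (f y)))
    × (∀ x y → _≈_ S (proj₁ (f x)) (proj₁ (f y)) → _≈_ S (proj₁ x) (proj₁ y))
    × (∀ (y : WedgeAt i′ j′ k′) → Σ (WedgeAt i j k) λ x → _≈_ S (proj₁ (f x)) (proj₁ y))
    × (∀ x → Closed (proj₁ x) → Closed (proj₁ (f x)))
    × (∀ x → ¬ Closed (proj₁ x) → ¬ Closed (proj₁ (f x)))

-- The triad Tr_{μ w} as an AN: actors p,q,r = 0,1,2; events numbered
-- in blocks of sizes μ₁ (p,q), μ₂ (q,r), μ₃ (p,r), w (p,q,r).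

data Kind : Set where
  pq qr pr pqr : Kind

kind : ∀ μ₁ μ₂ μ₃ w → Fin (μ₁ + μ₂ + μ₃ + w) → Kind
kind μ₁ μ₂ μ₃ w e with splitAt (μ₁ + μ₂ + μ₃) e
... | inj₂ _ = pqr
... | inj₁ e′ with splitAt (μ₁ + μ₂) e′
...   | inj₂ _ = pr
...   | inj₁ e″ with splitAt μ₁ e″
...     | inj₁ _ = pq
...     | inj₂ _ = qr

attends : Fin 3 → Kind → Bool
attends zero pq = true
attends (suc zero) pq = true
attends (suc zero) qr = true
attends (suc (suc zero)) qr = true
attends zero pr = true
attends (suc (suc zero)) pr = true
attends _ pqr = true
attends _ _ = false

Tr : ℕ → ℕ → ℕ → ℕ → AN
Tr μ₁ μ₂ μ₃ w = record
  { nA = 3 ; nE = μ₁ + μ₂ + μ₃ + w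
  ; adj = λ a e → attends a (kind μ₁ μ₂ μ₃ w e) }

-- Both parts rest on the symmetry of the 6-cycle X: every permutation of its three actors
-- extends to an automorphism of X, and such an automorphism is an injective induced map, so it
-- lies in 𝒞 by Axiom 1.  (i) The only triad of Tr_{μw} is Tr_{μw} itself, so precomposing a
-- given alcove with a suitable automorphism of X moves it to any ordered triple of distinct
-- actors.  (ii) The reflection of the path W swapping v₀ and v₄ is the restriction along ι of a
-- reflection of X; precomposing with it is an involution on wedges that reverses their actor
-- triple, respects ∼ (a congruence), and turns a factorisation through ι into another one.
module Submission where

open import Defs
open import Data.Nat using (ℕ; suc; _≤_; _<ᵇ_)
open import Data.Nat.Properties using (n<1+n)
open import Data.Fin using (Fin; toℕ; punchOut)
open import Data.Fin.Patterns
open import Data.Fin.Properties using (any?; _≟_; punchOut-injective; <⇒notInjective)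
open import Data.Product using (Σ; ∃; _×_; _,_; proj₁; proj₂)
open import Data.Bool using (Bool; T)
open import Data.Empty using (⊥-elim)
open import Relation.Nullary using (yes; no)
open import Relation.Binary.PropositionalEquality using (_≡_; _≢_; refl; sym; trans; cong; subst)
open import Function using (_∘_)
open import Function.Definitions using (Injective)

injective⇒surjective : ∀ {n} {f : Fin n → Fin n} → Injective _≡_ _≡_ f →
                       ∀ y → ∃ λ x → f x ≡ y
injective⇒surjective {suc n} {f} f-inj y with any? (λ x → f x ≟ y)
... | yes found = found
... | no missed = ⊥-elim (<⇒notInjective (n<1+n n) punchOut∘f-injective)
  where
  y≢f : ∀ x → y ≢ f x
  y≢f x y≡fx = missed (x , sym y≡fx)

  punchOut∘f-injective : Injective _≡_ _≡_ (λ x → punchOut (y≢f x))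
  punchOut∘f-injective eq = f-inj (punchOut-injective (y≢f _) (y≢f _) eq)

involution⇒injective : ∀ {A : Set} {f : A → A} → (∀ x → f (f x) ≡ x) → Injective _≡_ _≡_ f
involution⇒injective {f = f} ff≡id {x} {y} fx≡fy =
  trans (sym (ff≡id x)) (trans (cong f fx≡fy) (ff≡id y))

triple₃ : Fin 3 → Fin 3 → Fin 3 → Fin 3 → Fin 3
triple₃ a b c 0F = a
triple₃ a b c 1F = b
triple₃ a b c 2F = c

triple₃-injective : ∀ {a b c : Fin 3} → a ≢ b → b ≢ c → a ≢ c → Injective _≡_ _≡_ (triple₃ a b c)
triple₃-injective a≢b b≢c a≢c {0F} {0F} _ = refl
triple₃-injective a≢b b≢c a≢c {0F} {1F} e = ⊥-elim (a≢b e)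
triple₃-injective a≢b b≢c a≢c {0F} {2F} e = ⊥-elim (a≢c e)
triple₃-injective a≢b b≢c a≢c {1F} {0F} e = ⊥-elim (a≢b (sym e))
triple₃-injective a≢b b≢c a≢c {1F} {1F} _ = refl
triple₃-injective a≢b b≢c a≢c {1F} {2F} e = ⊥-elim (b≢c e)
triple₃-injective a≢b b≢c a≢c {2F} {0F} e = ⊥-elim (a≢c (sym e))
triple₃-injective a≢b b≢c a≢c {2F} {1F} e = ⊥-elim (b≢c (sym e))
triple₃-injective a≢b b≢c a≢c {2F} {2F} _ = refl

increasing-triple : ∀ {x y z : Fin 3} → T (toℕ x <ᵇ toℕ y) → T (toℕ y <ᵇ toℕ z) →
                    (x ≡ 0F) × (y ≡ 1F) × (z ≡ 2F)
increasing-triple {0F} {1F} {2F} _ _ = refl , refl , refl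
increasing-triple {0F} {0F} ()
increasing-triple {0F} {1F} {0F} _ ()
increasing-triple {0F} {1F} {1F} _ ()
increasing-triple {0F} {2F} {0F} _ ()
increasing-triple {0F} {2F} {1F} _ ()
increasing-triple {0F} {2F} {2F} _ ()
increasing-triple {1F} {0F} ()
increasing-triple {1F} {1F} ()
increasing-triple {1F} {2F} {0F} _ ()
increasing-triple {1F} {2F} {1F} _ ()
increasing-triple {1F} {2F} {2F} _ ()
increasing-triple {2F} {0F} ()
increasing-triple {2F} {1F} ()
increasing-triple {2F} {2F} ()

sel-three-actors : ∀ {m} {adj : Fin 3 → Fin m → Bool} →
                   (t : Triple (record { nA = 3 ; nE = m ; adj = adj })) → ∀ x → sel t x ≡ x
sel-three-actors (triple x y z x<y y<z) 0F = proj₁ (increasing-triple {x} {y} {z} x<y y<z)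
sel-three-actors (triple x y z x<y y<z) 1F = proj₁ (proj₂ (increasing-triple {x} {y} {z} x<y y<z))
sel-three-actors (triple x y z x<y y<z) 2F = proj₂ (proj₂ (increasing-triple {x} {y} {z} x<y y<z))

reflecting⇒induced : ∀ {H K} (f : Mor H K) →
                     (∀ a e → T (tadj K (fA f a) (fE f e)) → T (tadj H a e)) → Induced f
reflecting⇒induced f reflects a e p = a , e , reflects a e p , refl , refl

-- Each event of the 6-cycle X is attended by all actors but one, its opposite actor.
opposite : Fin 3 → Fin 3
opposite 0F = 2F
opposite 1F = 0F
opposite 2F = 1F

eventOpposite : Fin 3 → Fin 3
eventOpposite 0F = 1F
eventOpposite 1F = 2F
eventOpposite 2F = 0F

opposite-eventOpposite : ∀ a → opposite (eventOpposite a) ≡ a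
opposite-eventOpposite 0F = refl
opposite-eventOpposite 1F = refl
opposite-eventOpposite 2F = refl

eventOpposite-opposite : ∀ e → eventOpposite (opposite e) ≡ e
eventOpposite-opposite 0F = refl
eventOpposite-opposite 1F = refl
eventOpposite-opposite 2F = refl

xAdj⇒≢opposite : ∀ a e → T (xAdj a e) → a ≢ opposite e
xAdj⇒≢opposite 0F 0F _ ()
xAdj⇒≢opposite 0F 2F _ ()
xAdj⇒≢opposite 1F 0F _ ()
xAdj⇒≢opposite 1F 1F _ ()
xAdj⇒≢opposite 2F 1F _ ()
xAdj⇒≢opposite 2F 2F _ ()

≢opposite⇒xAdj : ∀ a e → a ≢ opposite e → T (xAdj a e)
≢opposite⇒xAdj 0F 0F _ = _
≢opposite⇒xAdj 0F 1F a≢ = ⊥-elim (a≢ refl)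
≢opposite⇒xAdj 0F 2F _ = _
≢opposite⇒xAdj 1F 0F _ = _
≢opposite⇒xAdj 1F 1F _ = _
≢opposite⇒xAdj 1F 2F a≢ = ⊥-elim (a≢ refl)
≢opposite⇒xAdj 2F 0F a≢ = ⊥-elim (a≢ refl)
≢opposite⇒xAdj 2F 1F _ = _
≢opposite⇒xAdj 2F 2F _ = _

module _ (π : Fin 3 → Fin 3) (π-injective : Injective _≡_ _≡_ π) where

  permuteEvents : Fin 3 → Fin 3
  permuteEvents = eventOpposite ∘ π ∘ opposite

  opposite-permuteEvents : ∀ e → opposite (permuteEvents e) ≡ π (opposite e)
  opposite-permuteEvents e = opposite-eventOpposite (π (opposite e))

  permuteEvents-injective : Injective _≡_ _≡_ permuteEvents
  permuteEvents-injective {e} {e′} eq = trans (sym (eventOpposite-opposite e))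
    (trans (cong eventOpposite (π-injective
      (trans (sym (opposite-permuteEvents e)) (trans (cong opposite eq) (opposite-permuteEvents e′)))))
    (eventOpposite-opposite e′))

  permuteX : Mor X X
  permuteX = record
    { fA = π ; fAinj = π-injective ; fE = permuteEvents
    ; hom = λ a e p → ≢opposite⇒xAdj (π a) (permuteEvents e) λ πa≡ →
        xAdj⇒≢opposite a e p (π-injective (trans πa≡ (opposite-permuteEvents e))) }

  permuteX-induced : Induced permuteX
  permuteX-induced = reflecting⇒induced permuteX λ a e p → ≢opposite⇒xAdj a e λ a≡ →
    xAdj⇒≢opposite (π a) (permuteEvents e) p (trans (cong π a≡) (sym (opposite-permuteEvents e)))

reverse₃ : Fin 3 → Fin 3
reverse₃ 0F = 2F
reverse₃ 1F = 1F
reverse₃ 2F = 0F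

reverse₃-involutive : ∀ a → reverse₃ (reverse₃ a) ≡ a
reverse₃-involutive 0F = refl
reverse₃-involutive 1F = refl
reverse₃-involutive 2F = refl

reverse₃-injective : Injective _≡_ _≡_ reverse₃
reverse₃-injective = involution⇒injective reverse₃-involutive

swap₂ : Fin 2 → Fin 2
swap₂ 0F = 1F
swap₂ 1F = 0F

swap₂-involutive : ∀ e → swap₂ (swap₂ e) ≡ e
swap₂-involutive 0F = refl
swap₂-involutive 1F = refl

wAdj-reverse : ∀ a e → wAdj (reverse₃ a) (swap₂ e) ≡ wAdj a e
wAdj-reverse 0F 0F = refl
wAdj-reverse 0F 1F = refl
wAdj-reverse 1F 0F = refl
wAdj-reverse 1F 1F = refl
wAdj-reverse 2F 0F = refl
wAdj-reverse 2F 1F = refl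

reflectW : Mor W W
reflectW = record
  { fA = reverse₃ ; fAinj = reverse₃-injective ; fE = swap₂
  ; hom = λ a e → subst T (sym (wAdj-reverse a e)) }

reflectW-induced : Induced reflectW
reflectW-induced = reflecting⇒induced reflectW λ a e → subst T (wAdj-reverse a e)

reflectW-involutive : ∀ {K} (φ : Mor W K) → ((φ ∘M reflectW) ∘M reflectW) ≐ φ
reflectW-involutive φ =
  (λ a → cong (fA φ) (reverse₃-involutive a)) , (λ e → cong (fE φ) (swap₂-involutive e))

reflectX : Mor X X
reflectX = permuteX reverse₃ reverse₃-injective

reflectX-ι : ∀ e → fE reflectX (ιE e) ≡ ιE (swap₂ e)
reflectX-ι 0F = refl
reflectX-ι 1F = refl

ιE-injective : Injective _≡_ _≡_ ιE
ιE-injective {0F} {0F} _ = refl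
ιE-injective {0F} {1F} ()
ιE-injective {1F} {0F} ()
ιE-injective {1F} {1F} _ = refl

xAdj-ι : ∀ a e → xAdj a (ιE e) ≡ wAdj a e
xAdj-ι 0F 0F = refl
xAdj-ι 0F 1F = refl
xAdj-ι 1F 0F = refl
xAdj-ι 1F 1F = refl
xAdj-ι 2F 0F = refl
xAdj-ι 2F 1F = refl

ι-induced : Induced ι
ι-induced = reflecting⇒induced ι λ a e → subst T (xAdj-ι a e)

module _ (S : CongSubcat) where

  precompose : ∀ {H H′ G} → Arrow S H G → (f : Mor H′ H) → C S f → Arrow S H′ G
  precompose (arr t φ φ∈C) f f∈C = arr t (φ ∘M f) (C-∘ S f∈C φ∈C)

  ∼-precompose : ∀ {H H′ K} {f : Mor H′ H} {φ ψ : Mor H K} →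
                 C S f → C S φ → C S ψ → _∼_ S φ ψ → _∼_ S (φ ∘M f) (ψ ∘M f)
  ∼-precompose f∈C φ∈C ψ∈C = ∼-∘ S f∈C f∈C φ∈C ψ∈C (∼-ext S ((λ _ → refl) , (λ _ → refl)))

  IsClosed : ∀ {K} → Mor W K → Set
  IsClosed {K} φ = Σ (Mor X K) λ ψ → C S ψ × _∼_ S φ (ψ ∘M ι)

  IsClosed-resp-∼ : ∀ {K} {φ φ′ : Mor W K} → _∼_ S φ φ′ → IsClosed φ′ → IsClosed φ
  IsClosed-resp-∼ φ∼φ′ (ψ , ψ∈C , φ′∼ψι) = ψ , ψ∈C , ∼-trans S φ∼φ′ φ′∼ψι

module _ (S : CongSubcat) (axiom1 : Axiom1 S) where

  permuteX∈C : (π : Fin 3 → Fin 3) (π-injective : Injective _≡_ _≡_ π) → C S (permuteX π π-injective)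
  permuteX∈C π π-injective =
    axiom1 _ (π-injective , permuteEvents-injective π π-injective) (permuteX-induced π π-injective)

  alcove-at-every-triple : ∀ μ₁ μ₂ μ₃ w → Alcove S (Tr μ₁ μ₂ μ₃ w) →
                           (a b c : Fin 3) → a ≢ b → b ≢ c → a ≢ c →
                           AlcoveAt S (Tr μ₁ μ₂ μ₃ w) a b c
  alcove-at-every-triple μ₁ μ₂ μ₃ w alcove@(arr t φ _) a b c a≢b b≢c a≢c =
    precompose S alcove (permuteX π π-injective) (permuteX∈C π π-injective) , at 0F , at 1F , at 2F
    where
    d : Fin 3 → Fin 3
    d = triple₃ a b c

    preimage : ∀ y → ∃ λ x → fA φ x ≡ y
    preimage = injective⇒surjective (fAinj φ)

    π : Fin 3 → Fin 3
    π x = proj₁ (preimage (d x))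

    π-injective : Injective _≡_ _≡_ π
    π-injective {x} {y} πx≡πy = triple₃-injective a≢b b≢c a≢c
      (trans (sym (proj₂ (preimage (d x)))) (trans (cong (fA φ) πx≡πy) (proj₂ (preimage (d y)))))

    at : ∀ x → sel t (fA φ (π x)) ≡ d x
    at x = trans (sel-three-actors t (fA φ (π x))) (proj₂ (preimage (d x)))

  reflectW∈C : C S reflectW
  reflectW∈C =
    axiom1 reflectW (reverse₃-injective , involution⇒injective swap₂-involutive) reflectW-induced

  ι∈C : C S ι
  ι∈C = axiom1 ι ((λ p → p) , ιE-injective) ι-induced

  ∼-reflectW : ∀ {K} {φ ψ : Mor W K} → C S φ → C S ψ →
               _∼_ S φ ψ → _∼_ S (φ ∘M reflectW) (ψ ∘M reflectW)
  ∼-reflectW = ∼-precompose S reflectW∈C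

  ∼-reflectW-twice : ∀ {K} (φ : Mor W K) → _∼_ S φ ((φ ∘M reflectW) ∘M reflectW)
  ∼-reflectW-twice φ = ∼-sym S (∼-ext S (reflectW-involutive φ))

  IsClosed-reflectW : ∀ {K} {φ : Mor W K} → C S φ → IsClosed S φ → IsClosed S (φ ∘M reflectW)
  IsClosed-reflectW φ∈C (ψ , ψ∈C , φ∼ψι) =
    ψ ∘M reflectX , C-∘ S (permuteX∈C reverse₃ reverse₃-injective) ψ∈C ,
    ∼-trans S (∼-reflectW φ∈C (C-∘ S ι∈C ψ∈C) φ∼ψι)
      (∼-ext S ((λ _ → refl) , (λ e → cong (fE ψ) (sym (reflectX-ι e)))))

  ∼-reflectW⁻¹ : ∀ {K} {φ ψ : Mor W K} → C S φ → C S ψ →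
                 _∼_ S (φ ∘M reflectW) (ψ ∘M reflectW) → _∼_ S φ ψ
  ∼-reflectW⁻¹ {φ = φ} {ψ} φ∈C ψ∈C φρ∼ψρ =
    ∼-trans S (∼-reflectW-twice φ)
      (∼-trans S (∼-reflectW (C-∘ S reflectW∈C φ∈C) (C-∘ S reflectW∈C ψ∈C) φρ∼ψρ)
        (∼-sym S (∼-reflectW-twice ψ)))

  IsClosed-reflectW⁻¹ : ∀ {K} {φ : Mor W K} → C S φ → IsClosed S (φ ∘M reflectW) → IsClosed S φ
  IsClosed-reflectW⁻¹ {φ = φ} φ∈C closed =
    IsClosed-resp-∼ S (∼-reflectW-twice φ) (IsClosed-reflectW (C-∘ S reflectW∈C φ∈C) closed)

  module _ (G : AN) where

    reverseWedge : ∀ {i j k} → WedgeAt S G i j k → WedgeAt S G k j i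
    reverseWedge (wedge , at-i , at-j , at-k) =
      precompose S wedge reflectW reflectW∈C , at-k , at-j , at-i

    reverseWedge-bijection : (i j k : Fin (nA G)) → WedgeBijection S G i j k k j i
    reverseWedge-bijection i j k = reverseWedge ,
      (λ { (arr _ _ φ∈C , _) (arr _ _ ψ∈C , _) (rel φ∼ψ) → rel (∼-reflectW φ∈C ψ∈C φ∼ψ) }) ,
      (λ { (arr _ _ φ∈C , _) (arr _ _ ψ∈C , _) (rel φρ∼ψρ) → rel (∼-reflectW⁻¹ φ∈C ψ∈C φρ∼ψρ) }) ,
      (λ { y@(arr _ φ _ , _) → reverseWedge y , rel (∼-sym S (∼-reflectW-twice φ)) }) ,
      (λ { (arr _ _ φ∈C , _) → IsClosed-reflectW φ∈C }) ,
      (λ { (arr _ _ φ∈C , _) open′ → open′ ∘ IsClosed-reflectW⁻¹ φ∈C })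

lemma1 : (S : CongSubcat) → Axiom1 S →
    ((μ₁ μ₂ μ₃ w : ℕ) → μ₂ ≤ μ₁ → μ₃ ≤ μ₂ →
      Alcove S (Tr μ₁ μ₂ μ₃ w) →
      (a b c : Fin 3) → a ≢ b → b ≢ c → a ≢ c →
      AlcoveAt S (Tr μ₁ μ₂ μ₃ w) a b c)
    × ((G : AN) (i j k : Fin (nA G)) → WedgeBijection S G i j k k j i)
lemma1 S axiom1 =
  (λ μ₁ μ₂ μ₃ w _ _ → alcove-at-every-triple S axiom1 μ₁ μ₂ μ₃ w) ,
  (λ G → reverseWedge-bijection S axiom1 G)
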